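{- Let $a,b,D\in\mathbb{Z}$ with $D\ne1$ a fundamental discriminant, $b>0$, $4Da^3\ne27b$, $\gcd(a,b_3)=1$ where $b=b_1b_3^3$ with $b_1$ cubefree; let $K=\mathbb{Q}(\sqrt D)$, $\tau$ its nontrivial automorphism, and let $v=v_1+v_2\sqrt D\in\mathbb{Z}_K$ be primitive with $v\tau(v)$ divisible only by primes split in $K$, and with $v_2\in\mathbb{Z}$ if $D\equiv0\pmod4$. If $p\ne3$ is a prime ramified in $K$, then the cubic $$2v_2X^3+2Dv_1Y^3+\frac{2b}{v_1^2-Dv_2^2}Z^3+6v_1X^2Y+6v_2DXY^2+2a(X^2Z-DY^2Z)=0$$ has a nontrivial solution in $\mathbb{Q}_p$.
   Context: An algebraic integer $v\in\mathbb{Z}_K$ is primitive if $v/n\in\mathbb{Z}_K$ with $n\in\mathbb{Z}$ implies $n=\pm1$. -}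

module Defs where

open import Data.Nat as ℕ using (ℕ)
open import Data.Nat.Divisibility as ℕD using ()
open import Data.Integer
open import Data.Integer.Divisibility using (_∣_)
open import Data.Product using (Σ; _×_; ∃)
open import Data.Sum using (_⊎_)
open import Relation.Binary.PropositionalEquality using (_≡_)
open import Relation.Nullary using (¬_)
open import Data.Nat.Primality using (Prime)

SquarefreeZ : ℤ → Set
SquarefreeZ n = ∀ (d : ℕ) → + (d ℕ.* d) ∣ n → d ≡ 1

Cubefree : ℕ → Set
Cubefree b = ∀ (d : ℕ) → (d ℕ.* d ℕ.* d) ℕD.∣ b → d ≡ 1

FundamentalDisc : ℤ → Set
FundamentalDisc D =
  ((+ 4 ∣ (D - + 1)) × SquarefreeZ D)
  ⊎ Σ ℤ (λ m → (D ≡ + 4 * m) × ((+ 4 ∣ (m - + 2)) ⊎ (+ 4 ∣ (m - + 3))) × SquarefreeZ m)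

-- The element (x + y √D)/2 of K = ℚ(√D) lies in ℤ_K = ℤ[(D+√D)/2]
-- iff x ≡ y D (mod 2)   (D a fundamental discriminant).
InZK : ℤ → ℤ → ℤ → Set
InZK D x y = + 2 ∣ (x - y * D)

Primitive : ℤ → ℤ → ℤ → Set
Primitive D x y = ∀ (n x' y' : ℤ) → x ≡ n * x' → y ≡ n * y' → InZK D x' y' → ∣ n ∣ ≡ 1

-- the rational prime q splits in K = ℚ(√D) (D ≡ 0,1 mod 4):
-- q ∤ D and D is a square modulo 4q (Kronecker symbol (D/q) = 1)
SplitIn : ℤ → ℕ → Set
SplitIn D q = Prime q × ¬ (+ q ∣ D) × ∃ (λ (t : ℤ) → + (4 ℕ.* q) ∣ (t * t - D))

RamifiedIn : ℤ → ℕ → Set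
RamifiedIn D q = Prime q × (+ q ∣ D)

-- 4 · N(v) for v = (x + y √D)/2, i.e. 4 v τ(v) = x² − D y²
norm4 : ℤ → ℤ → ℤ → ℤ
norm4 D x y = x * x - D * (y * y)

-- p-adic integers as the inverse limit of ℤ/p^k:
-- coherent sequences (seq k mod p^k)
record ℤₚ (p : ℕ) : Set where
  field
    seq : ℕ → ℤ
    coh : ∀ k → + (p ℕ.^ k) ∣ (seq (ℕ.suc k) - seq k)
open ℤₚ public

IsZeroSeq : ℕ → (ℕ → ℤ) → Set
IsZeroSeq p s = ∀ k → + (p ℕ.^ k) ∣ s k

IsZeroₚ : {p : ℕ} → ℤₚ p → Set
IsZeroₚ {p} x = IsZeroSeq p (seq x)

-- The cubic of the statement with v1 = x/2, v2 = y/2, multiplied through by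
-- the nonzero integer M = x² − D y² = 4 N(v) (so all coefficients are integers):
-- y M X³ + D x M Y³ + 8 b Z³ + 3 x M X²Y + 3 y D M XY² + 2 a M (X²Z − D Y²Z)
cubic : (a b D x y : ℤ) → ℤ → ℤ → ℤ → ℤ
cubic a b D x y X Y Z =
  let M = norm4 D x y in
  y * M * (X * X * X) + D * x * M * (Y * Y * Y) + + 8 * b * (Z * Z * Z)
  + + 3 * x * M * (X * X * Y) + + 3 * y * D * M * (X * Y * Y)
  + + 2 * a * M * (X * X * Z - D * (Y * Y * Z))

-- the cubic has a nontrivial zero in ℚ_p  (equivalently, by homogeneity,
-- a zero (X,Y,Z) ∈ ℤ_p³ with not all coordinates 0)
HasNontrivialZeroQp : (p : ℕ) → (a b D x y : ℤ) → Set
HasNontrivialZeroQp p a b D x y =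
  Σ (ℤₚ p) λ X → Σ (ℤₚ p) λ Y → Σ (ℤₚ p) λ Z →
    IsZeroSeq p (λ k → cubic a b D x y (seq X k) (seq Y k) (seq Z k))
    × ¬ (IsZeroₚ X × IsZeroₚ Y × IsZeroₚ Z)

{-# OPTIONS --safe #-}
module Submission where

-- On the line X = 1, Z = 0 the cubic is (x² − Dy²) · g(Y), where g(Y) = y + 3xY + 3DyY² + DxY³
-- (Z₀-slice) is the √D-part of (x + y√D)(1 + Y√D)³. At a ramified p the coefficients 3Dy and Dx
-- vanish mod p, so g is linear mod p with slope 3x, and as p ≠ 3 Hensel's lemma yields a root in
-- ℤ_p once p ∤ x. For odd p, p ∣ x would give 4p ∣ x² − Dy², forcing p to split. For p = 2 we have
-- 4 ∣ D, so x and y are even, and primitivity of v makes x/2 odd; the argument then applies to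
-- (x/2, y/2).

open import Defs
open import Data.Nat as ℕ using (ℕ)
open import Data.Nat.GCD using (gcd)
open import Data.Nat.Primality using (Prime)
open import Data.Integer
open import Data.Integer.Divisibility using (_∣_)
open import Data.Product using (Σ; _×_)
open import Relation.Binary.PropositionalEquality using (_≡_; _≢_)

open import Data.Empty using (⊥-elim)
open import Data.Integer.Divisibility.Signed as S using (divides; ∣ᵤ⇒∣; ∣⇒∣ᵤ)
open import Data.Integer.Properties
  using (pos-*; pos-+; *-comm; *-assoc; +-inverseʳ; neg-distribˡ-*; abs-*)
open import Data.Integer.Tactic.RingSolver using (solve-∀)
open import Data.Nat.Base using (nonTrivial⇒≢1)
open import Data.Nat.Coprimality using (Coprime; coprime-Bézout)
import Data.Nat.Divisibility as ℕ∣
open import Data.Nat.GCD using (module Bézout)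
open import Data.Nat.Primality
  using (prime?; prime[2]; prime⇒irreducible; prime⇒nonTrivial; euclidsLemma)
import Data.Nat.Properties as ℕ
open import Data.Product using (_,_; proj₁; proj₂)
open import Data.Sum using (inj₁; inj₂)
open import Data.Unit using (tt)
open import Function using (_∘_)
open import Relation.Binary.PropositionalEquality
  using (refl; sym; trans; cong; cong₂; subst; subst₂; module ≡-Reasoning)
open import Relation.Nullary using (¬_; yes; no; contradiction)
open import Relation.Nullary.Decidable using (toWitness)

cubicPoly : ℤ → ℤ → ℤ → ℤ → ℤ → ℤ
cubicPoly c₀ c₁ c₂ c₃ Y = c₀ + c₁ * Y + c₂ * (Y * Y) + c₃ * (Y * Y * Y)

cubicPoly-taylor : ∀ c₀ c₁ c₂ c₃ Y t →
  cubicPoly c₀ c₁ c₂ c₃ (Y + t)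
    ≡ cubicPoly c₀ c₁ c₂ c₃ Y
      + t * (c₁ + (c₂ * (+ 2 * Y + t) + c₃ * (+ 3 * (Y * Y) + + 3 * Y * t + t * t)))
cubicPoly-taylor = expanded
  where
  expanded : ∀ c₀ c₁ c₂ c₃ Y t →
    c₀ + c₁ * (Y + t) + c₂ * ((Y + t) * (Y + t)) + c₃ * ((Y + t) * (Y + t) * (Y + t))
      ≡ c₀ + c₁ * Y + c₂ * (Y * Y) + c₃ * (Y * Y * Y)
        + t * (c₁ + (c₂ * (+ 2 * Y + t) + c₃ * (+ 3 * (Y * Y) + + 3 * Y * t + t * t)))
  expanded = solve-∀

module _ {p : ℕ} {c₀ c₁ c₂ c₃ u : ℤ}
         (p∣c₂ : + p S.∣ c₂) (p∣c₃ : + p S.∣ c₃) (p∣c₁u-1 : + p S.∣ c₁ * u - + 1) where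

  private
    f : ℤ → ℤ
    f = cubicPoly c₀ c₁ c₂ c₃

  hensel-step : ∀ k {Y} → + (p ℕ.^ k) S.∣ f Y →
                Σ ℤ λ Y′ → + (p ℕ.^ k) S.∣ Y′ - Y × + (p ℕ.^ ℕ.suc k) S.∣ f Y′
  -- Newton's step Y ↦ Y − u f(Y), with u standing in for 1 / f′(Y) ≡ 1 / c₁ (mod p).
  hensel-step k {Y} (divides q fY≡qP) =
    Y + t , divides (- (q * u)) (shift Y t) , p^[1+k]∣fY′
    where
    P = + (p ℕ.^ k)
    t = - (q * u) * P
    R = c₂ * (+ 2 * Y + t) + c₃ * (+ 3 * (Y * Y) + + 3 * Y * t + t * t)

    shift : ∀ Y t → (Y + t) - Y ≡ t
    shift = solve-∀

    regroup : ∀ P q u c₁ R → q * P + (- (q * u) * P) * (c₁ + R) ≡ P * - (q * (c₁ * u - + 1) + q * u * R)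
    regroup = solve-∀

    fY′-factored : f (Y + t) ≡ P * - (q * (c₁ * u - + 1) + q * u * R)
    fY′-factored = begin
      f (Y + t)                        ≡⟨ cubicPoly-taylor c₀ c₁ c₂ c₃ Y t ⟩
      f Y + t * (c₁ + R)               ≡⟨ cong (_+ t * (c₁ + R)) fY≡qP ⟩
      q * P + t * (c₁ + R)             ≡⟨ regroup P q u c₁ R ⟩
      P * - (q * (c₁ * u - + 1) + q * u * R) ∎
      where open ≡-Reasoning

    p∣R : + p S.∣ R
    p∣R = S.∣m∣n⇒∣m+n (S.∣m⇒∣m*n _ p∣c₂) (S.∣m⇒∣m*n _ p∣c₃)

    p^[1+k]≡P*p : + (p ℕ.^ ℕ.suc k) ≡ P * + p
    p^[1+k]≡P*p = trans (pos-* p (p ℕ.^ k)) (*-comm (+ p) P)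

    p^[1+k]∣fY′ : + (p ℕ.^ ℕ.suc k) S.∣ f (Y + t)
    p^[1+k]∣fY′ = subst₂ S._∣_ (sym p^[1+k]≡P*p) (sym fY′-factored)
      (S.*-monoʳ-∣ P (S.∣m⇒∣-m (S.∣m∣n⇒∣m+n (S.∣n⇒∣m*n q p∣c₁u-1) (S.∣n⇒∣m*n (q * u) p∣R))))

  approximate-root : ∀ k → Σ ℤ λ Y → + (p ℕ.^ k) S.∣ f Y
  approximate-root ℕ.zero    = + 0 , S.∣ᵤ⇒∣ (ℕ∣.1∣ _)
  approximate-root (ℕ.suc k) = proj₁ next , proj₂ (proj₂ next)
    where next = hensel-step k (proj₂ (approximate-root k))

  hensel-cubic : Σ (ℤₚ p) λ Y → IsZeroSeq p (f ∘ seq Y)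
  hensel-cubic = root , ∣⇒∣ᵤ ∘ proj₂ ∘ approximate-root
    where
    root : ℤₚ p
    seq root = proj₁ ∘ approximate-root
    coh root k = ∣⇒∣ᵤ (proj₁ (proj₂ (hensel-step k (proj₂ (approximate-root k)))))

prime≢1 : ∀ {p} → Prime p → p ≢ 1
prime≢1 p-prime = nonTrivial⇒≢1 {{prime⇒nonTrivial p-prime}}

constantℤₚ : ∀ {p} → ℕ → ℤₚ p
seq (constantℤₚ n) _ = + n
coh (constantℤₚ {p} n) k = subst (λ z → p ℕ.^ k ℕ∣.∣ ∣ z ∣) (sym (+-inverseʳ (+ n))) (ℕ∣._∣0 (p ℕ.^ k))

nontrivial-zero-on-Z≡0 : ∀ {p} a b D x y → Prime p → (M : ℤ) (g : ℤ → ℤ)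
  → (∀ Y → cubic a b D x y (+ 1) Y (+ 0) ≡ M * g Y)
  → Σ (ℤₚ p) (λ Y → IsZeroSeq p (g ∘ seq Y))
  → HasNontrivialZeroQp p a b D x y
nontrivial-zero-on-Z≡0 {p} a b D x y p-prime M g cubic≡M*g (Y , gY≡0) =
  constantℤₚ 1 , Y , constantℤₚ 0 ,
  (λ k → subst (+ (p ℕ.^ k) ∣_) (sym (cubic≡M*g (seq Y k)))
                (S.∣⇒∣ᵤ (S.∣n⇒∣m*n M (∣ᵤ⇒∣ {+ (p ℕ.^ k)} (gY≡0 k))))) ,
  λ (1≡0 , _) → prime≢1 p-prime (trans (sym (ℕ.*-identityʳ p)) (ℕ∣.∣1⇒≡1 (1≡0 1)))

ℕ-identity⇒ℤ : ∀ a b c d e → a ℕ.+ b ℕ.* c ≡ d ℕ.* e → + a + + b * + c ≡ + d * + e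
ℕ-identity⇒ℤ a b c d e eq = begin
  + a + + b * + c   ≡⟨ cong (λ z → + a + z) (pos-* b c) ⟨
  + a + + (b ℕ.* c) ≡⟨ pos-+ a (b ℕ.* c) ⟨
  + (a ℕ.+ b ℕ.* c) ≡⟨ cong +_ eq ⟩
  + (d ℕ.* e)       ≡⟨ pos-* d e ⟩
  + d * + e         ∎
  where open ≡-Reasoning

∣prime⇒≡ : ∀ {p q} → Prime p → Prime q → p ℕ∣.∣ q → p ≡ q
∣prime⇒≡ p-prime q-prime p∣q with prime⇒irreducible q-prime p∣q
... | inj₁ p≡1 = ⊥-elim (prime≢1 p-prime p≡1)
... | inj₂ p≡q = p≡q

prime∤⇒coprime : ∀ {p n} → Prime p → ¬ p ℕ∣.∣ n → Coprime p n
prime∤⇒coprime p-prime p∤n (d∣p , d∣n) with prime⇒irreducible p-prime d∣p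
... | inj₁ d≡1 = d≡1
... | inj₂ refl = ⊥-elim (p∤n d∣n)

bézout⇒inverse : ∀ {p n} → Bézout.Identity 1 p n → Σ ℤ λ u → + p S.∣ + n * u - + 1
bézout⇒inverse {p} {n} (Bézout.+- x y 1+yn≡xp) = - + y , divides (- + x) (begin
  + n * - + y - + 1   ≡⟨ regroup (+ n) (+ y) ⟩
  - (+ 1 + + y * + n) ≡⟨ cong -_ (ℕ-identity⇒ℤ 1 y n x p 1+yn≡xp) ⟩
  - (+ x * + p)       ≡⟨ neg-distribˡ-* (+ x) (+ p) ⟩
  - + x * + p         ∎)
  where
  open ≡-Reasoning
  regroup : ∀ n y → n * - y - + 1 ≡ - (+ 1 + y * n)
  regroup = solve-∀
bézout⇒inverse {p} {n} (Bézout.-+ x y 1+xp≡yn) = + y , divides (+ x) (begin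
  + n * + y - + 1       ≡⟨ cong (_- + 1) (*-comm (+ n) (+ y)) ⟩
  + y * + n - + 1       ≡⟨ cong (_- + 1) (ℕ-identity⇒ℤ 1 x p y n 1+xp≡yn) ⟨
  + 1 + + x * + p - + 1 ≡⟨ cancel (+ x * + p) ⟩
  + x * + p             ∎)
  where
  open ≡-Reasoning
  cancel : ∀ m → + 1 + m - + 1 ≡ m
  cancel = solve-∀

unit-mod-prime : ∀ {p} → Prime p → (c : ℤ) → ¬ (+ p ∣ c) → Σ ℤ λ u → + p S.∣ c * u - + 1
unit-mod-prime p-prime c p∤c
  with bézout⇒inverse (coprime-Bézout (prime∤⇒coprime p-prime p∤c))
unit-mod-prime p-prime (+ n)      p∤c | u , p∣nu-1 = u , p∣nu-1
unit-mod-prime p-prime -[1+ n ]   p∤c | u , p∣nu-1 =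
  - u , subst (λ z → _ S.∣ z - + 1) (sym (neg-*-neg (+ ℕ.suc n) u)) p∣nu-1
  where
  neg-*-neg : ∀ m u → - m * - u ≡ m * u
  neg-*-neg = solve-∀

Z₀-slice : ℤ → ℤ → ℤ → ℤ → ℤ
Z₀-slice D x y = cubicPoly y (+ 3 * x) (+ 3 * D * y) (D * x)

cubic-on-Z≡0 : ∀ a b D x y Y → cubic a b D x y (+ 1) Y (+ 0) ≡ norm4 D x y * Z₀-slice D x y Y
cubic-on-Z≡0 = expanded
  where
  expanded : ∀ a b D x y Y →
    y * (x * x - D * (y * y)) * (+ 1 * + 1 * + 1) + D * x * (x * x - D * (y * y)) * (Y * Y * Y)
    + + 8 * b * (+ 0 * + 0 * + 0) + + 3 * x * (x * x - D * (y * y)) * (+ 1 * + 1 * Y)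
    + + 3 * y * D * (x * x - D * (y * y)) * (+ 1 * Y * Y)
    + + 2 * a * (x * x - D * (y * y)) * (+ 1 * + 1 * + 0 - D * (Y * Y * + 0))
      ≡ (x * x - D * (y * y)) * (y + + 3 * x * Y + + 3 * D * y * (Y * Y) + D * x * (Y * Y * Y))
  expanded = solve-∀

Z₀-slice-double : ∀ D x y Y → Z₀-slice D (x * + 2) (y * + 2) Y ≡ + 2 * Z₀-slice D x y Y
Z₀-slice-double = expanded
  where
  expanded : ∀ D x y Y →
    y * + 2 + + 3 * (x * + 2) * Y + + 3 * D * (y * + 2) * (Y * Y) + D * (x * + 2) * (Y * Y * Y)
      ≡ + 2 * (y + + 3 * x * Y + + 3 * D * y * (Y * Y) + D * x * (Y * Y * Y))
  expanded = solve-∀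

ramified-slice-root : ∀ {p} D x y → Prime p → p ≢ 3 → + p ∣ D → ¬ (+ p ∣ x)
  → Σ (ℤₚ p) λ Y → IsZeroSeq p (Z₀-slice D x y ∘ seq Y)
ramified-slice-root {p} D x y p-prime p≢3 p∣D p∤x =
  hensel-cubic {c₀ = y} {c₁ = + 3 * x} (S.∣m⇒∣m*n y (S.∣n⇒∣m*n (+ 3) p∣ˢD)) (S.∣m⇒∣m*n x p∣ˢD)
               (proj₂ (unit-mod-prime p-prime (+ 3 * x) p∤3x))
  where
  p∣ˢD : + p S.∣ D
  p∣ˢD = ∣ᵤ⇒∣ p∣D

  p∤3x : ¬ (+ p ∣ + 3 * x)
  p∤3x p∣3x with euclidsLemma 3 ∣ x ∣ p-prime (subst (p ℕ∣.∣_) (abs-* (+ 3) x) p∣3x)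
  ... | inj₁ p∣3 = p≢3 (∣prime⇒≡ p-prime (toWitness {a? = prime? 3} tt) p∣3)
  ... | inj₂ p∣x = p∤x p∣x

even*even : ∀ a b → + 2 ∣ a → + 2 ∣ b → + 4 ∣ a * b
even*even a b 2∣a 2∣b = subst (4 ℕ∣.∣_) (sym (abs-* a b)) (ℕ∣.*-pres-∣ 2∣a 2∣b)

fundamentalDisc⇒4∣D[D-1] : ∀ D → FundamentalDisc D → + 4 S.∣ D * (D - + 1)
fundamentalDisc⇒4∣D[D-1] D (inj₁ (4∣D-1 , _))      = S.∣n⇒∣m*n D (∣ᵤ⇒∣ 4∣D-1)
fundamentalDisc⇒4∣D[D-1] D (inj₂ (m , D≡4m , _)) =
  S.∣m⇒∣m*n (D - + 1) (divides m (trans D≡4m (*-comm (+ 4) m)))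

4∣norm4 : ∀ D x y → FundamentalDisc D → InZK D x y → + 4 ∣ norm4 D x y
4∣norm4 D x y disc 2∣x-yD =
  subst (+ 4 ∣_) (sym (norm4-split D x y))
    (∣⇒∣ᵤ (S.∣m∣n⇒∣m+n (∣ᵤ⇒∣ {+ 4} {(x - y * D) * x+yD} (even*even (x - y * D) x+yD 2∣x-yD 2∣x+yD))
                       (S.∣m⇒∣m*n (y * y) (fundamentalDisc⇒4∣D[D-1] D disc))))
  where
  x+yD : ℤ
  x+yD = x - y * D + + 2 * (y * D)

  norm4-split : ∀ D x y → x * x - D * (y * y)
                         ≡ (x - y * D) * (x - y * D + + 2 * (y * D)) + D * (D - + 1) * (y * y)
  norm4-split = solve-∀

  2∣x+yD : + 2 ∣ x+yD
  2∣x+yD = ∣⇒∣ᵤ (S.∣m∣n⇒∣m+n (∣ᵤ⇒∣ {+ 2} {x - y * D} 2∣x-yD) (S.∣m⇒∣m*n (y * D) S.∣-refl))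

4∣∧odd-prime∣⇒4p∣ : ∀ {p n} → Prime p → p ≢ 2 → 4 ℕ∣.∣ n → p ℕ∣.∣ n → 4 ℕ.* p ℕ∣.∣ n
4∣∧odd-prime∣⇒4p∣ {p} p-prime p≢2 (ℕ∣.divides k n≡k*4) p∣n
  with euclidsLemma k 4 p-prime (subst (p ℕ∣.∣_) n≡k*4 p∣n)
... | inj₁ p∣k = subst (4 ℕ.* p ℕ∣.∣_) (trans (ℕ.*-comm 4 k) (sym n≡k*4)) (ℕ∣.*-monoʳ-∣ 4 p∣k)
... | inj₂ p∣4 with euclidsLemma 2 2 p-prime p∣4
...   | inj₁ p∣2 = contradiction (∣prime⇒≡ p-prime prime[2] p∣2) p≢2
...   | inj₂ p∣2 = contradiction (∣prime⇒≡ p-prime prime[2] p∣2) p≢2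

ramified-odd⇒∤x : ∀ {p} D x y → FundamentalDisc D → InZK D x y
  → (∀ (q : ℕ) → Prime q → + (4 ℕ.* q) ∣ norm4 D x y → SplitIn D q)
  → Prime p → p ≢ 2 → + p ∣ D → ¬ (+ p ∣ x)
ramified-odd⇒∤x {p} D x y disc inZK split p-prime p≢2 p∣D p∣x = p∤D p∣D
  where
  p∣norm4 : + p ∣ norm4 D x y
  p∣norm4 = ∣⇒∣ᵤ (S.∣m∣n⇒∣m-n (S.∣m⇒∣m*n x (∣ᵤ⇒∣ {+ p} {x} p∣x))
                             (S.∣m⇒∣m*n (y * y) (∣ᵤ⇒∣ {+ p} {D} p∣D)))

  p∤D : ¬ (+ p ∣ D)
  p∤D = proj₁ (proj₂ (split p p-prime (4∣∧odd-prime∣⇒4p∣ p-prime p≢2 (4∣norm4 D x y disc inZK) p∣norm4)))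

fundamentalDisc-even⇒4∣ : ∀ D → FundamentalDisc D → + 2 ∣ D → + 4 S.∣ D
fundamentalDisc-even⇒4∣ D (inj₁ (4∣D-1 , _)) 2∣D = contradiction (ℕ∣.∣1⇒≡1 2∣1) λ ()
  where
  D-[D-1]≡1 : ∀ D → D - (D - + 1) ≡ + 1
  D-[D-1]≡1 = solve-∀

  2∣1 : 2 ℕ∣.∣ 1
  2∣1 = ∣⇒∣ᵤ (subst (+ 2 S.∣_) (D-[D-1]≡1 D)
          (S.∣m∣n⇒∣m-n (∣ᵤ⇒∣ {+ 2} {D} 2∣D)
                       (S.∣-trans (divides (+ 2) refl) (∣ᵤ⇒∣ {+ 4} {D - + 1} 4∣D-1))))
fundamentalDisc-even⇒4∣ D (inj₂ (m , D≡4m , _)) _ = divides m (trans D≡4m (*-comm (+ 4) m))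

dyadic-halving : ∀ D x y → FundamentalDisc D → + 2 ∣ D → InZK D x y → Primitive D x y
  → (+ 4 ∣ D → + 2 ∣ y)
  → Σ ℤ λ x′ → Σ ℤ λ y′ → x ≡ x′ * + 2 × y ≡ y′ * + 2 × ¬ (+ 2 ∣ x′)
dyadic-halving D x y disc 2∣D inZK v-primitive 4∣D⇒2∣y = x′ , y′ , x≡x′*2 , y≡y′*2 , x′-odd
  where
  x-yD+yD≡x : ∀ x y D → x - y * D + y * D ≡ x
  x-yD+yD≡x = solve-∀

  2∣ˢD : + 2 S.∣ D
  2∣ˢD = ∣ᵤ⇒∣ 2∣D

  2∣x : + 2 S.∣ x
  2∣x = subst (+ 2 S.∣_) (x-yD+yD≡x x y D)
          (S.∣m∣n⇒∣m+n (∣ᵤ⇒∣ {+ 2} {x - y * D} inZK) (S.∣n⇒∣m*n y 2∣ˢD))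

  2∣y : + 2 S.∣ y
  2∣y = ∣ᵤ⇒∣ (4∣D⇒2∣y (∣⇒∣ᵤ (fundamentalDisc-even⇒4∣ D disc 2∣D)))

  open S._∣_ 2∣x using () renaming (quotient to x′; equality to x≡x′*2)
  open S._∣_ 2∣y using () renaming (quotient to y′; equality to y≡y′*2)

  x′-odd : ¬ (+ 2 ∣ x′)
  x′-odd 2∣x′ with v-primitive (+ 2) x′ y′ (trans x≡x′*2 (*-comm x′ (+ 2))) (trans y≡y′*2 (*-comm y′ (+ 2)))
                    (∣⇒∣ᵤ (S.∣m∣n⇒∣m-n (∣ᵤ⇒∣ {+ 2} {x′} 2∣x′) (S.∣n⇒∣m*n y′ 2∣ˢD)))
  ... | ()

halved-cubic-on-Z≡0 : ∀ a b D x y x′ y′ → x ≡ x′ * + 2 → y ≡ y′ * + 2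
  → ∀ Y → cubic a b D x y (+ 1) Y (+ 0) ≡ (norm4 D x y * + 2) * Z₀-slice D x′ y′ Y
halved-cubic-on-Z≡0 a b D x y x′ y′ x≡x′*2 y≡y′*2 Y = begin
  cubic a b D x y (+ 1) Y (+ 0)                    ≡⟨ cubic-on-Z≡0 a b D x y Y ⟩
  N * Z₀-slice D x y Y                             ≡⟨ cong (N *_) (cong₂ (λ x y → Z₀-slice D x y Y) x≡x′*2 y≡y′*2) ⟩
  N * Z₀-slice D (x′ * + 2) (y′ * + 2) Y           ≡⟨ cong (N *_) (Z₀-slice-double D x′ y′ Y) ⟩
  N * (+ 2 * Z₀-slice D x′ y′ Y)                   ≡⟨ *-assoc N (+ 2) (Z₀-slice D x′ y′ Y) ⟨
  (N * + 2) * Z₀-slice D x′ y′ Y                   ∎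
  where
  open ≡-Reasoning
  N = norm4 D x y

lemma6p10 : (a b D : ℤ) → FundamentalDisc D → D ≢ + 1 → + 0 < b
    → + 4 * D * (a * a * a) ≢ + 27 * b
    → Σ ℕ (λ b₁ → Σ ℕ (λ b₃ → (b ≡ + (b₁ ℕ.* b₃ ℕ.^ 3)) × Cubefree b₁ × (gcd ∣ a ∣ b₃ ≡ 1)))
    → (x y : ℤ) → InZK D x y → Primitive D x y
    → (∀ (q : ℕ) → Prime q → + (4 ℕ.* q) ∣ norm4 D x y → SplitIn D q)
    → (+ 4 ∣ D → + 2 ∣ y)
    → (p : ℕ) → RamifiedIn D p → p ≢ 3
    → HasNontrivialZeroQp p a b D x y
lemma6p10 a b D disc _ _ _ _ x y inZK v-primitive split 4∣D⇒2∣y p (p-prime , p∣D) p≢3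
  with p ℕ.≟ 2
... | no p≢2 =
  nontrivial-zero-on-Z≡0 a b D x y p-prime (norm4 D x y) (Z₀-slice D x y) (cubic-on-Z≡0 a b D x y)
    (ramified-slice-root D x y p-prime p≢3 p∣D (ramified-odd⇒∤x D x y disc inZK split p-prime p≢2 p∣D))
... | yes refl =
  let x′ , y′ , x≡x′*2 , y≡y′*2 , x′-odd = dyadic-halving D x y disc p∣D inZK v-primitive 4∣D⇒2∣y in
  nontrivial-zero-on-Z≡0 a b D x y p-prime (norm4 D x y * + 2) (Z₀-slice D x′ y′)
    (halved-cubic-on-Z≡0 a b D x y x′ y′ x≡x′*2 y≡y′*2) (ramified-slice-root D x′ y′ p-prime p≢3 p∣D x′-odd)
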